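{- If $\Gamma\vdash M:A$ is derivable in $\Lambda_\cap$, then $\Gamma\vdash_s M:A$ is derivable in $\Lambda_\cap^s$.
   Context: $\lambda$-terms: $M::=x\mid MM\mid\lambda x.M$ modulo $\alpha$-conversion; $M[x:=N]$ capture-avoiding substitution. Types: $A::=\varphi\mid A\to A\mid A\cap A$. A typing context is a finite set of pairs $x:A$ ($\Gamma,x:A$ denotes $\Gamma\cup\{x:A\}$; $x\notin\Gamma$ means no $x:B$ lies in $\Gamma$); in $\Lambda_\cap$ its variables are pairwise distinct, in $\Lambda_\cap^s$ a variable may occur with several types. $\Lambda_\cap$: (Ax) $\Gamma,x:A\vdash x:A$; ($\to$I) from $\Gamma,x:A\vdash M:B$, $x\notin\Gamma$, infer $\Gamma\vdash\lambda x.M:A\to B$; ($\to$E) from $\Gamma\vdash M:A\to B$ and $\Gamma\vdash N:A$ infer $\Gamma\vdash MN:B$; ($\cap$I) from $\Gamma\vdash M:A$, $\Gamma\vdash M:B$ infer $\Gamma\vdash M:A\cap B$; ($\cap$E) from $\Gamma\vdash M:A\cap B$ infer $\Gamma\vdash M:A$ and $\Gamma\vdash M:B$. $\Lambda_\cap^s$ ($n\ge0$): (Ax) $\Gamma,x:A\vdash_s x:A$; $(\mathsf{Beta})^s$ from $\Gamma\vdash_s M[x:=N]N_1\dots N_n:A$ and $\Gamma\vdash_s N:B$ infer $\Gamma\vdash_s(\lambda x.M)NN_1\dots N_n:A$; $(\mathsf{L}\to)$ from $\Gamma\vdash_s N:A_1$ and $\Gamma,y:A_2\vdash_s yN_1\dots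 N_n:B$, with $y\notin FV(N_1)\cup\dots\cup FV(N_n)$, $y\notin\Gamma$, infer $\Gamma,x:A_1\to A_2\vdash_s xNN_1\dots N_n:B$; $(\mathsf{R}\to)$ from $\Gamma,x:A\vdash_s M:B$, $x\notin\Gamma$, infer $\Gamma\vdash_s\lambda x.M:A\to B$; $(\mathsf{L}\cap)$ from $\Gamma,x:A_1,x:A_2\vdash_s xN_1\dots N_n:B$ infer $\Gamma,x:A_1\cap A_2\vdash_s xN_1\dots N_n:B$; $(\mathsf{R}\cap)$ from $\Gamma\vdash_s M:A$ and $\Gamma\vdash_s M:B$ infer $\Gamma\vdash_s M:A\cap B$. -}

module Defs where

open import Data.Nat using (ℕ; zero; suc; _+_; _<ᵇ_; _≡ᵇ_; pred)
open import Data.Bool using (if_then_else_)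
open import Data.Product using (_×_; _,_; Σ)
open import Data.List using (List; []; _∷_; map; foldl)
open import Data.List.Membership.Propositional using (_∈_)
open import Data.Sum using (_⊎_)
open import Relation.Binary.PropositionalEquality using (_≡_; _≢_)
open import Relation.Nullary using (¬_)

-- λ-terms modulo α-conversion: de Bruijn indices (α-equivalence is identity).
data Term : Set where
  var : ℕ → Term
  app : Term → Term → Term
  lam : Term → Term

shift : ℕ → ℕ → Term → Term
shift d c (var i) = if i <ᵇ c then var i else var (i + d)
shift d c (app M N) = app (shift d c M) (shift d c N)
shift d c (lam M) = lam (shift d (suc c) M)

-- sub k N M : substitute N for index k in M (removing the binder)
sub : ℕ → Term → Term → Term
sub k N (var i) =
  if i <ᵇ k then var i else (if i ≡ᵇ k then shift k 0 N else var (pred i))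
sub k N (app M P) = app (sub k N M) (sub k N P)
sub k N (lam M) = lam (sub (suc k) N M)

-- M[x:=N] for the variable bound by λ in λx.M
_[0:=_] : Term → Term → Term
M [0:= N ] = sub 0 N M

_·⃗_ : Term → List Term → Term
M ·⃗ Ns = foldl app M Ns

data _FreeIn_ : ℕ → Term → Set where
  fv-var : ∀ {x} → x FreeIn var x
  fv-appˡ : ∀ {x M N} → x FreeIn M → x FreeIn app M N
  fv-appʳ : ∀ {x M N} → x FreeIn N → x FreeIn app M N
  fv-lam : ∀ {x M} → suc x FreeIn M → x FreeIn lam M

data _NotFreeInAll_ (x : ℕ) : List Term → Set where
  []  : x NotFreeInAll []
  _∷_ : ∀ {N Ns} → ¬ (x FreeIn N) → x NotFreeInAll Ns → x NotFreeInAll (N ∷ Ns)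

infixr 7 _⇒_
infixr 8 _∩_
data Type : Set where
  atom : ℕ → Type
  _⇒_ : Type → Type → Type
  _∩_ : Type → Type → Type

-- Contexts: finite sets of pairs x : A, represented by lists up to set equality
Ctx : Set
Ctx = List (ℕ × Type)

_≋_ : Ctx → Ctx → Set
Γ ≋ Δ = ∀ p → (p ∈ Γ → p ∈ Δ) × (p ∈ Δ → p ∈ Γ)

_∉dom_ : ℕ → Ctx → Set
x ∉dom Γ = ∀ B → ¬ ((x , B) ∈ Γ)

Distinct : Ctx → Set
Distinct Γ = ∀ x A B → (x , A) ∈ Γ → (x , B) ∈ Γ → A ≡ B

shiftCtx : Ctx → Ctx
shiftCtx = map (λ { (x , A) → (suc x , A) })

data _⊢_∶_ : Ctx → Term → Type → Set where
  Ax  : ∀ {Γ x A} → Distinct Γ → (x , A) ∈ Γ → Γ ⊢ var x ∶ A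
  →I  : ∀ {Γ M A B} → ((0 , A) ∷ shiftCtx Γ) ⊢ M ∶ B → Γ ⊢ lam M ∶ (A ⇒ B)
  →E  : ∀ {Γ M N A B} → Γ ⊢ M ∶ (A ⇒ B) → Γ ⊢ N ∶ A → Γ ⊢ app M N ∶ B
  ∩I  : ∀ {Γ M A B} → Γ ⊢ M ∶ A → Γ ⊢ M ∶ B → Γ ⊢ M ∶ (A ∩ B)
  ∩E₁ : ∀ {Γ M A B} → Γ ⊢ M ∶ (A ∩ B) → Γ ⊢ M ∶ A
  ∩E₂ : ∀ {Γ M A B} → Γ ⊢ M ∶ (A ∩ B) → Γ ⊢ M ∶ B

data _⊢ˢ_∶_ : Ctx → Term → Type → Set where
  Ax   : ∀ {Γ x A} → (x , A) ∈ Γ → Γ ⊢ˢ var x ∶ A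
  Beta : ∀ {Γ M N Ns A B} →
         Γ ⊢ˢ ((M [0:= N ]) ·⃗ Ns) ∶ A → Γ ⊢ˢ N ∶ B →
         Γ ⊢ˢ (app (lam M) N ·⃗ Ns) ∶ A
  L→   : ∀ {Γ Δ x y N Ns A₁ A₂ B} →
         Δ ≋ ((x , A₁ ⇒ A₂) ∷ Γ) →
         y NotFreeInAll Ns → y ∉dom Γ →
         Γ ⊢ˢ N ∶ A₁ → ((y , A₂) ∷ Γ) ⊢ˢ (var y ·⃗ Ns) ∶ B →
         Δ ⊢ˢ (app (var x) N ·⃗ Ns) ∶ B
  R→   : ∀ {Γ M A B} → ((0 , A) ∷ shiftCtx Γ) ⊢ˢ M ∶ B → Γ ⊢ˢ lam M ∶ (A ⇒ B)
  L∩   : ∀ {Γ Δ x Ns A₁ A₂ B} →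
         Δ ≋ ((x , A₁ ∩ A₂) ∷ Γ) →
         ((x , A₁) ∷ (x , A₂) ∷ Γ) ⊢ˢ (var x ·⃗ Ns) ∶ B →
         Δ ⊢ˢ (var x ·⃗ Ns) ∶ B
  R∩   : ∀ {Γ M A B} → Γ ⊢ˢ M ∶ A → Γ ⊢ˢ M ∶ B → Γ ⊢ˢ M ∶ (A ∩ B)

-- Ax, →I and ∩I of Λ∩ are also rules of Λ∩ˢ, so the theorem amounts to the admissibility
-- of →E and ∩E in Λ∩ˢ.  ∩E is pushed up to the axioms, where it becomes
-- an L∩ step.  →E is admissible by cut elimination, proved together with a substitution
-- lemma by induction on the size of the cut formula and then on derivations: a
-- substitution is admissible at size n if it sends every variable either to a variable of
-- the same type or to a term typed at a type of size < n.  Applying an R→-derivation of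
-- λM to N becomes a Beta step whose reduct M[0:=N] is typed by substitution, and an L→ on
-- a variable x that is substituted by a term t becomes an application of t, at a type
-- smaller than that of x.
module Submission where

open import Defs
open import Data.Nat using (ℕ; zero; suc; _+_; _<ᵇ_; _≡ᵇ_; pred; _⊔_; _≤_; _<_; s≤s)
open import Data.Nat.Properties
  using (_≟_; m≤m⊔n; m≤n⊔m; ≤-trans; <-≤-trans; <-trans; <-irrefl; ≤-refl; m≤m+n; m≤n+m;
         n<1+n; suc[m]≤n⇒m≤pred[n]; +-suc; +-identityʳ)
open import Data.Bool using (true; false)
open import Data.Product using (_×_; _,_; ∃; proj₁; proj₂)
open import Data.List using (List; []; _∷_; map; _++_)
open import Data.List.Relation.Unary.Any using (here; there)
open import Data.List.Membership.Propositional using (_∈_)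
open import Function using (id; _∘_)
open import Relation.Binary.PropositionalEquality
  using (_≡_; _≢_; refl; sym; trans; cong; cong₂; subst; module ≡-Reasoning)
open import Relation.Nullary using (¬_; yes; no)
open import Data.Empty using (⊥-elim)

-- Parallel renaming and substitution

ext : (ℕ → ℕ) → ℕ → ℕ
ext ρ zero    = zero
ext ρ (suc i) = suc (ρ i)

rename : (ℕ → ℕ) → Term → Term
rename ρ (var i)   = var (ρ i)
rename ρ (app M N) = app (rename ρ M) (rename ρ N)
rename ρ (lam M)   = lam (rename (ext ρ) M)

exts : (ℕ → Term) → ℕ → Term
exts σ zero    = var zero
exts σ (suc i) = rename suc (σ i)

substitute : (ℕ → Term) → Term → Term
substitute σ (var i)   = σ i
substitute σ (app M N) = app (substitute σ M) (substitute σ N)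
substitute σ (lam M)   = lam (substitute (exts σ) M)

rename-cong-FV : ∀ {ρ ρ′} M → (∀ x → x FreeIn M → ρ x ≡ ρ′ x) → rename ρ M ≡ rename ρ′ M
rename-cong-FV (var i)   h = cong var (h i fv-var)
rename-cong-FV (app M N) h =
  cong₂ app (rename-cong-FV M (λ x → h x ∘ fv-appˡ)) (rename-cong-FV N (λ x → h x ∘ fv-appʳ))
rename-cong-FV {ρ} {ρ′} (lam M) h = cong lam (rename-cong-FV M ext-agrees)
  where
  ext-agrees : ∀ x → x FreeIn M → ext ρ x ≡ ext ρ′ x
  ext-agrees zero    _ = refl
  ext-agrees (suc x) p = cong suc (h x (fv-lam p))

rename-cong : ∀ {ρ ρ′} M → (∀ x → ρ x ≡ ρ′ x) → rename ρ M ≡ rename ρ′ M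
rename-cong M h = rename-cong-FV M (λ x _ → h x)

substitute-cong-FV : ∀ {σ τ} M → (∀ x → x FreeIn M → σ x ≡ τ x) →
                     substitute σ M ≡ substitute τ M
substitute-cong-FV (var i)   h = h i fv-var
substitute-cong-FV (app M N) h =
  cong₂ app (substitute-cong-FV M (λ x → h x ∘ fv-appˡ))
            (substitute-cong-FV N (λ x → h x ∘ fv-appʳ))
substitute-cong-FV {σ} {τ} (lam M) h = cong lam (substitute-cong-FV M exts-agrees)
  where
  exts-agrees : ∀ x → x FreeIn M → exts σ x ≡ exts τ x
  exts-agrees zero    _ = refl
  exts-agrees (suc x) p = cong (rename suc) (h x (fv-lam p))

substitute-cong : ∀ {σ τ} M → (∀ x → σ x ≡ τ x) → substitute σ M ≡ substitute τ M
substitute-cong M h = substitute-cong-FV M (λ x _ → h x)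

rename-id : ∀ M → rename id M ≡ M
rename-id (var i)   = refl
rename-id (app M N) = cong₂ app (rename-id M) (rename-id N)
rename-id (lam M)   = cong lam (trans (rename-cong M ext-id) (rename-id M))
  where
  ext-id : ∀ x → ext id x ≡ x
  ext-id zero    = refl
  ext-id (suc x) = refl

rename-rename : ∀ ρ τ M → rename ρ (rename τ M) ≡ rename (ρ ∘ τ) M
rename-rename ρ τ (var i)   = refl
rename-rename ρ τ (app M N) = cong₂ app (rename-rename ρ τ M) (rename-rename ρ τ N)
rename-rename ρ τ (lam M)   =
  cong lam (trans (rename-rename (ext ρ) (ext τ) M) (rename-cong M ext-∘))
  where
  ext-∘ : ∀ x → ext ρ (ext τ x) ≡ ext (ρ ∘ τ) x
  ext-∘ zero    = refl
  ext-∘ (suc x) = refl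

rename-as-substitute : ∀ ρ M → rename ρ M ≡ substitute (var ∘ ρ) M
rename-as-substitute ρ (var i)   = refl
rename-as-substitute ρ (app M N) =
  cong₂ app (rename-as-substitute ρ M) (rename-as-substitute ρ N)
rename-as-substitute ρ (lam M)   =
  cong lam (trans (rename-as-substitute (ext ρ) M) (substitute-cong M var-ext))
  where
  var-ext : ∀ x → var (ext ρ x) ≡ exts (var ∘ ρ) x
  var-ext zero    = refl
  var-ext (suc x) = refl

substitute-rename : ∀ σ τ M → substitute σ (rename τ M) ≡ substitute (σ ∘ τ) M
substitute-rename σ τ (var i)   = refl
substitute-rename σ τ (app M N) =
  cong₂ app (substitute-rename σ τ M) (substitute-rename σ τ N)
substitute-rename σ τ (lam M)   =
  cong lam (trans (substitute-rename (exts σ) (ext τ) M) (substitute-cong M exts-ext))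
  where
  exts-ext : ∀ x → exts σ (ext τ x) ≡ exts (σ ∘ τ) x
  exts-ext zero    = refl
  exts-ext (suc x) = refl

rename-substitute : ∀ ρ σ M → rename ρ (substitute σ M) ≡ substitute (rename ρ ∘ σ) M
rename-substitute ρ σ (var i)   = refl
rename-substitute ρ σ (app M N) =
  cong₂ app (rename-substitute ρ σ M) (rename-substitute ρ σ N)
rename-substitute ρ σ (lam M)   =
  cong lam (trans (rename-substitute (ext ρ) (exts σ) M) (substitute-cong M ext-exts))
  where
  ext-exts : ∀ x → rename (ext ρ) (exts σ x) ≡ exts (rename ρ ∘ σ) x
  ext-exts zero    = refl
  ext-exts (suc x) = trans (rename-rename (ext ρ) suc (σ x)) (sym (rename-rename suc ρ (σ x)))

substitute-substitute : ∀ σ τ M →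
                        substitute σ (substitute τ M) ≡ substitute (substitute σ ∘ τ) M
substitute-substitute σ τ (var i)   = refl
substitute-substitute σ τ (app M N) =
  cong₂ app (substitute-substitute σ τ M) (substitute-substitute σ τ N)
substitute-substitute σ τ (lam M)   =
  cong lam (trans (substitute-substitute (exts σ) (exts τ) M) (substitute-cong M exts-exts))
  where
  exts-exts : ∀ x → substitute (exts σ) (exts τ x) ≡ exts (substitute σ ∘ τ) x
  exts-exts zero    = refl
  exts-exts (suc x) =
    trans (substitute-rename (exts σ) suc (τ x)) (sym (rename-substitute suc σ (τ x)))

substitute-var : ∀ M → substitute var M ≡ M
substitute-var M = trans (sym (rename-as-substitute id M)) (rename-id M)

-- M [0:= N ] as a parallel substitution

shiftVar : ℕ → ℕ → ℕ → ℕ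
shiftVar d c i with i <ᵇ c
... | true  = i
... | false = i + d

shift-as-rename : ∀ d c M → shift d c M ≡ rename (shiftVar d c) M
shift-as-rename d c (var i) with i <ᵇ c
... | true  = refl
... | false = refl
shift-as-rename d c (app M N) = cong₂ app (shift-as-rename d c M) (shift-as-rename d c N)
shift-as-rename d c (lam M)   =
  cong lam (trans (shift-as-rename d (suc c) M) (rename-cong M shiftVar-suc))
  where
  shiftVar-suc : ∀ x → shiftVar d (suc c) x ≡ ext (shiftVar d c) x
  shiftVar-suc zero = refl
  shiftVar-suc (suc x) with x <ᵇ c
  ... | true  = refl
  ... | false = refl

shift-suc : ∀ k N → shift (suc k) 0 N ≡ rename suc (shift k 0 N)
shift-suc k N = begin
  shift (suc k) 0 N                    ≡⟨ shift-as-rename (suc k) 0 N ⟩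
  rename (λ j → j + suc k) N           ≡⟨ rename-cong N (λ j → +-suc j k) ⟩
  rename (suc ∘ shiftVar k 0) N        ≡⟨ rename-rename suc (shiftVar k 0) N ⟨
  rename suc (rename (shiftVar k 0) N) ≡⟨ cong (rename suc) (shift-as-rename k 0 N) ⟨
  rename suc (shift k 0 N)             ∎
  where open ≡-Reasoning

shift-zero : ∀ N → shift 0 0 N ≡ N
shift-zero N =
  trans (shift-as-rename 0 0 N) (trans (rename-cong N +-identityʳ) (rename-id N))

subVar : ℕ → Term → ℕ → Term
subVar k N i = sub k N (var i)

subVar-suc : ∀ k N i → subVar (suc k) N i ≡ exts (subVar k N) i
subVar-suc k       N zero          = refl
subVar-suc zero    N (suc zero)    = shift-suc 0 N
subVar-suc zero    N (suc (suc j)) = refl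
subVar-suc (suc k) N (suc zero)    = refl
subVar-suc (suc k) N (suc (suc j)) with j <ᵇ k | j ≡ᵇ k
... | true  | _     = refl
... | false | true  = shift-suc (suc k) N
... | false | false = refl

sub-as-substitute : ∀ k N M → sub k N M ≡ substitute (subVar k N) M
sub-as-substitute k N (var i)   = refl
sub-as-substitute k N (app M P) = cong₂ app (sub-as-substitute k N M) (sub-as-substitute k N P)
sub-as-substitute k N (lam M)   =
  cong lam (trans (sub-as-substitute (suc k) N M) (substitute-cong M (subVar-suc k N)))

_•_ : Term → (ℕ → Term) → ℕ → Term
(N • σ) zero    = N
(N • σ) (suc i) = σ i

[0:=]-as-substitute : ∀ N M → M [0:= N ] ≡ substitute (N • var) M
[0:=]-as-substitute N M = trans (sub-as-substitute 0 N M) (substitute-cong M subVar-zero)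
  where
  subVar-zero : ∀ i → subVar 0 N i ≡ (N • var) i
  subVar-zero zero    = shift-zero N
  subVar-zero (suc i) = refl

substitute-[0:=] : ∀ σ N M →
                   substitute σ (M [0:= N ]) ≡ substitute (exts σ) M [0:= substitute σ N ]
substitute-[0:=] σ N M = begin
  substitute σ (M [0:= N ])                         ≡⟨ cong (substitute σ) ([0:=]-as-substitute N M) ⟩
  substitute σ (substitute (N • var) M)             ≡⟨ substitute-substitute σ (N • var) M ⟩
  substitute (substitute σ ∘ (N • var)) M           ≡⟨ substitute-cong M commute ⟩
  substitute (substitute (N′ • var) ∘ exts σ) M     ≡⟨ substitute-substitute (N′ • var) (exts σ) M ⟨
  substitute (N′ • var) (substitute (exts σ) M)     ≡⟨ [0:=]-as-substitute N′ (substitute (exts σ) M) ⟨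
  substitute (exts σ) M [0:= N′ ]                   ∎
  where
  open ≡-Reasoning
  N′ = substitute σ N
  commute : ∀ x → substitute σ ((N • var) x) ≡ substitute (N′ • var) (exts σ x)
  commute zero    = refl
  commute (suc x) = sym (trans (substitute-rename (N′ • var) suc (σ x)) (substitute-var (σ x)))

rename-[0:=] : ∀ ρ N M → rename ρ (M [0:= N ]) ≡ rename (ext ρ) M [0:= rename ρ N ]
rename-[0:=] ρ N M = begin
  rename ρ (M [0:= N ])                                  ≡⟨ rename-as-substitute ρ _ ⟩
  substitute (var ∘ ρ) (M [0:= N ])                      ≡⟨ substitute-[0:=] (var ∘ ρ) N M ⟩
  substitute (exts (var ∘ ρ)) M [0:= substitute (var ∘ ρ) N ]
    ≡⟨ cong₂ _[0:=_] (trans (substitute-cong M exts-var) (sym (rename-as-substitute (ext ρ) M)))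
                     (sym (rename-as-substitute ρ N)) ⟩
  rename (ext ρ) M [0:= rename ρ N ]                     ∎
  where
  open ≡-Reasoning
  exts-var : ∀ x → exts (var ∘ ρ) x ≡ var (ext ρ x)
  exts-var zero    = refl
  exts-var (suc x) = refl

•-rename-[0:=] : ∀ N ρ M → substitute (N • (var ∘ ρ)) M ≡ rename (ext ρ) M [0:= N ]
•-rename-[0:=] N ρ M = sym (begin
  rename (ext ρ) M [0:= N ]                   ≡⟨ [0:=]-as-substitute N (rename (ext ρ) M) ⟩
  substitute (N • var) (rename (ext ρ) M)     ≡⟨ substitute-rename (N • var) (ext ρ) M ⟩
  substitute ((N • var) ∘ ext ρ) M            ≡⟨ substitute-cong M •-ext ⟩
  substitute (N • (var ∘ ρ)) M                ∎)
  where
  open ≡-Reasoning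
  •-ext : ∀ x → (N • var) (ext ρ x) ≡ (N • (var ∘ ρ)) x
  •-ext zero    = refl
  •-ext (suc x) = refl

rename-·⃗ : ∀ ρ M Ns → rename ρ (M ·⃗ Ns) ≡ rename ρ M ·⃗ map (rename ρ) Ns
rename-·⃗ ρ M []       = refl
rename-·⃗ ρ M (N ∷ Ns) = rename-·⃗ ρ (app M N) Ns

substitute-·⃗ : ∀ σ M Ns → substitute σ (M ·⃗ Ns) ≡ substitute σ M ·⃗ map (substitute σ) Ns
substitute-·⃗ σ M []       = refl
substitute-·⃗ σ M (N ∷ Ns) = substitute-·⃗ σ (app M N) Ns

·⃗-snoc : ∀ M Ns N → app (M ·⃗ Ns) N ≡ M ·⃗ (Ns ++ N ∷ [])
·⃗-snoc M []       N = refl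
·⃗-snoc M (P ∷ Ns) N = ·⃗-snoc (app M P) Ns N

rename-·⃗-snoc : ∀ ρ M Ns N →
                 app (rename ρ (M ·⃗ Ns)) N ≡ rename ρ M ·⃗ (map (rename ρ) Ns ++ N ∷ [])
rename-·⃗-snoc ρ M Ns N =
  trans (cong (λ X → app X N) (rename-·⃗ ρ M Ns)) (·⃗-snoc (rename ρ M) (map (rename ρ) Ns) N)

update : {X : Set} → (ℕ → X) → ℕ → X → ℕ → X
update f y a x with x ≟ y
... | yes _ = a
... | no  _ = f x

update-≡ : ∀ {X : Set} (f : ℕ → X) y a → update f y a y ≡ a
update-≡ f y a with y ≟ y
... | yes _  = refl
... | no y≢y = ⊥-elim (y≢y refl)

update-≢ : ∀ {X : Set} (f : ℕ → X) y a x → x ≢ y → update f y a x ≡ f x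
update-≢ f y a x x≢y with x ≟ y
... | yes x≡y = ⊥-elim (x≢y x≡y)
... | no  _   = refl

FreeIn-≢ : ∀ {x y N} → ¬ (y FreeIn N) → x FreeIn N → x ≢ y
FreeIn-≢ y∉N x∈N refl = y∉N x∈N

rename-update-head : ∀ ρ {y} y′ {Ns} → y NotFreeInAll Ns →
                     rename (update ρ y y′) (var y ·⃗ Ns) ≡ var y′ ·⃗ map (rename ρ) Ns
rename-update-head ρ {y} y′ {Ns} y∉Ns =
  trans (rename-·⃗ _ (var y) Ns) (cong₂ _·⃗_ (cong var (update-≡ ρ y y′)) (tail y∉Ns))
  where
  tail : ∀ {Ns} → y NotFreeInAll Ns → map (rename (update ρ y y′)) Ns ≡ map (rename ρ) Ns
  tail []           = refl
  tail (y∉N ∷ y∉Ns) =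
    cong₂ _∷_ (rename-cong-FV _ (λ x x∈N → update-≢ ρ y y′ x (FreeIn-≢ y∉N x∈N))) (tail y∉Ns)

substitute-update-head : ∀ σ {y} t {Ns} → y NotFreeInAll Ns →
                         substitute (update σ y t) (var y ·⃗ Ns) ≡ t ·⃗ map (substitute σ) Ns
substitute-update-head σ {y} t {Ns} y∉Ns =
  trans (substitute-·⃗ _ (var y) Ns) (cong₂ _·⃗_ (update-≡ σ y t) (tail y∉Ns))
  where
  tail : ∀ {Ns} → y NotFreeInAll Ns → map (substitute (update σ y t)) Ns ≡ map (substitute σ) Ns
  tail []           = refl
  tail (y∉N ∷ y∉Ns) =
    cong₂ _∷_ (substitute-cong-FV _ (λ x x∈N → update-≢ σ y t x (FreeIn-≢ y∉N x∈N))) (tail y∉Ns)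

-- Fresh variables

fvBound : Term → ℕ
fvBound (var i)   = suc i
fvBound (app M N) = fvBound M ⊔ fvBound N
fvBound (lam M)   = pred (fvBound M)

FreeIn⇒<fvBound : ∀ {x} M → x FreeIn M → x < fvBound M
FreeIn⇒<fvBound (var i)   fv-var     = n<1+n i
FreeIn⇒<fvBound (app M N) (fv-appˡ p) = ≤-trans (FreeIn⇒<fvBound M p) (m≤m⊔n _ _)
FreeIn⇒<fvBound (app M N) (fv-appʳ p) = ≤-trans (FreeIn⇒<fvBound N p) (m≤n⊔m _ _)
FreeIn⇒<fvBound (lam M)   (fv-lam p) = suc[m]≤n⇒m≤pred[n] (FreeIn⇒<fvBound M p)

fvsBound : List Term → ℕ
fvsBound []       = 0
fvsBound (N ∷ Ns) = fvBound N ⊔ fvsBound Ns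

fvsBound≤⇒NotFreeInAll : ∀ {y} Ns → fvsBound Ns ≤ y → y NotFreeInAll Ns
fvsBound≤⇒NotFreeInAll []       _ = []
fvsBound≤⇒NotFreeInAll (N ∷ Ns) b≤y =
  (λ y∈N → <-irrefl refl (<-≤-trans (FreeIn⇒<fvBound N y∈N) (≤-trans (m≤m⊔n _ _) b≤y)))
  ∷ fvsBound≤⇒NotFreeInAll Ns (≤-trans (m≤n⊔m (fvBound N) _) b≤y)

domBound : Ctx → ℕ
domBound []             = 0
domBound ((x , _) ∷ Γ) = suc x ⊔ domBound Γ

∈⇒<domBound : ∀ {x C} Γ → (x , C) ∈ Γ → x < domBound Γ
∈⇒<domBound ((z , _) ∷ Γ) (here refl) = m≤m⊔n (suc z) (domBound Γ)
∈⇒<domBound ((z , _) ∷ Γ) (there m)   = ≤-trans (∈⇒<domBound Γ m) (m≤n⊔m (suc z) _)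

domBound≤⇒∉dom : ∀ {y} Γ → domBound Γ ≤ y → y ∉dom Γ
domBound≤⇒∉dom Γ b≤y B m = <-irrefl refl (<-≤-trans (∈⇒<domBound Γ m) b≤y)

∉dom⇒≢ : ∀ {x y C Γ} → y ∉dom Γ → (x , C) ∈ Γ → x ≢ y
∉dom⇒≢ y∉Γ m refl = y∉Γ _ m

≋-here : ∀ {Γ p Γ₀} → Γ ≋ (p ∷ Γ₀) → p ∈ Γ
≋-here eq = proj₂ (eq _) (here refl)

≋-there : ∀ {Γ p Γ₀ q} → Γ ≋ (p ∷ Γ₀) → q ∈ Γ₀ → q ∈ Γ
≋-there eq m = proj₂ (eq _) (there m)

∈⇒≋∷ : ∀ {p Γ} → p ∈ Γ → Γ ≋ (p ∷ Γ)
∈⇒≋∷ p∈Γ q = there , λ { (here refl) → p∈Γ ; (there m) → m }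

∈-shiftCtx⁺ : ∀ {Γ v C} → (v , C) ∈ Γ → (suc v , C) ∈ shiftCtx Γ
∈-shiftCtx⁺ (here refl) = here refl
∈-shiftCtx⁺ (there m)   = there (∈-shiftCtx⁺ m)

∈-shiftCtx⁻ : ∀ Γ {w C} → (w , C) ∈ shiftCtx Γ → ∃ λ v → w ≡ suc v × (v , C) ∈ Γ
∈-shiftCtx⁻ ((v , _) ∷ Γ) (here refl) = v , refl , here refl
∈-shiftCtx⁻ (_ ∷ Γ)       (there m) with ∈-shiftCtx⁻ Γ m
... | v , refl , m′ = v , refl , there m′

Renaming : (ℕ → ℕ) → Ctx → Ctx → Set
Renaming ρ Γ Δ = ∀ {x C} → (x , C) ∈ Γ → (ρ x , C) ∈ Δ

Renaming-∷ : ∀ {ρ Γ Δ x A} → Renaming ρ Γ Δ → Renaming ρ ((x , A) ∷ Γ) ((ρ x , A) ∷ Δ)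
Renaming-∷ h (here refl) = here refl
Renaming-∷ h (there m)   = there (h m)

Renaming-suc : ∀ {Δ A} → Renaming suc Δ ((0 , A) ∷ shiftCtx Δ)
Renaming-suc m = there (∈-shiftCtx⁺ m)

Renaming-ext : ∀ {ρ Δ A} Γ → Renaming ρ Γ Δ →
               Renaming (ext ρ) ((0 , A) ∷ shiftCtx Γ) ((0 , A) ∷ shiftCtx Δ)
Renaming-ext Γ h (here refl) = here refl
Renaming-ext Γ h (there m) with ∈-shiftCtx⁻ Γ m
... | v , refl , m′ = Renaming-suc (h m′)

Renaming-update : ∀ {ρ Γ Δ y y′ A} → y ∉dom Γ → Renaming ρ Γ Δ →
                  Renaming (update ρ y y′) ((y , A) ∷ Γ) ((y′ , A) ∷ Δ)
Renaming-update {ρ} {y = y} {y′} y∉Γ h (here refl) =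
  here (cong (_, _) (update-≡ ρ y y′))
Renaming-update {ρ} {Δ = Δ} {y} {y′} y∉Γ h {x} {C} (there m) =
  there (subst (λ w → (w , C) ∈ Δ) (sym (update-≢ ρ y y′ x (∉dom⇒≢ y∉Γ m))) (h m))

-- Structural properties of Λ∩ˢ

cast : ∀ {Γ M M′ A} → M ≡ M′ → Γ ⊢ˢ M ∶ A → Γ ⊢ˢ M′ ∶ A
cast refl d = d

L→-∈ : ∀ {Δ x N Ns A₁ A₂ B} → (x , A₁ ⇒ A₂) ∈ Δ → Δ ⊢ˢ N ∶ A₁ →
       (∀ y → ((y , A₂) ∷ Δ) ⊢ˢ var y ·⃗ Ns ∶ B) → Δ ⊢ˢ app (var x) N ·⃗ Ns ∶ B
L→-∈ {Δ} {Ns = Ns} x∈Δ dN dy =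
  L→ (∈⇒≋∷ x∈Δ) (fvsBound≤⇒NotFreeInAll Ns (m≤n⊔m _ _))
     (domBound≤⇒∉dom Δ (m≤m⊔n _ _)) dN (dy (domBound Δ ⊔ fvsBound Ns))

L∩-∈ : ∀ {Δ x Ns A₁ A₂ B} → (x , A₁ ∩ A₂) ∈ Δ →
       ((x , A₁) ∷ (x , A₂) ∷ Δ) ⊢ˢ var x ·⃗ Ns ∶ B → Δ ⊢ˢ var x ·⃗ Ns ∶ B
L∩-∈ {Ns = Ns} x∈Δ = L∩ {Ns = Ns} (∈⇒≋∷ x∈Δ)

rename-⊢ˢ : ∀ {Γ Δ M A} ρ → Renaming ρ Γ Δ → Γ ⊢ˢ M ∶ A → Δ ⊢ˢ rename ρ M ∶ A
rename-⊢ˢ ρ h (Ax m) = Ax (h m)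
rename-⊢ˢ ρ h (Beta {M = M} {N} {Ns} d₁ d₂) =
  cast (sym (rename-·⃗ ρ (app (lam M) N) Ns))
    (Beta {M = rename (ext ρ) M} {Ns = map (rename ρ) Ns}
      (cast (trans (rename-·⃗ ρ _ Ns) (cong (_·⃗ map (rename ρ) Ns) (rename-[0:=] ρ N M)))
            (rename-⊢ˢ ρ h d₁))
      (rename-⊢ˢ ρ h d₂))
rename-⊢ˢ {Δ = Δ} ρ h (L→ {Γ₀} {x = x} {y = y} {N} {Ns} eq y∉Ns y∉Γ d₁ d₂) =
  cast (sym (rename-·⃗ ρ (app (var x) N) Ns))
    (L→-∈ {Ns = map (rename ρ) Ns} (h (≋-here eq)) (rename-⊢ˢ ρ h₀ d₁) λ y′ →
      cast (rename-update-head ρ y′ y∉Ns)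
           (rename-⊢ˢ (update ρ y y′) (Renaming-update y∉Γ h₀) d₂))
  where
  h₀ : Renaming ρ Γ₀ Δ
  h₀ m = h (≋-there eq m)
rename-⊢ˢ ρ h (R→ {Γ} d) = R→ (rename-⊢ˢ (ext ρ) (Renaming-ext Γ h) d)
rename-⊢ˢ ρ h (L∩ {x = x} {Ns} eq d) =
  cast (sym (rename-·⃗ ρ (var x) Ns))
    (L∩-∈ {Ns = map (rename ρ) Ns} (h (≋-here eq))
      (cast (rename-·⃗ ρ (var x) Ns)
            (rename-⊢ˢ ρ (Renaming-∷ (Renaming-∷ λ m → h (≋-there eq m))) d)))
rename-⊢ˢ ρ h (R∩ d₁ d₂) = R∩ (rename-⊢ˢ ρ h d₁) (rename-⊢ˢ ρ h d₂)

weaken-⊢ˢ : ∀ {Γ Δ M A} → (∀ {p} → p ∈ Γ → p ∈ Δ) → Γ ⊢ˢ M ∶ A → Δ ⊢ˢ M ∶ A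
weaken-⊢ˢ {M = M} Γ⊆Δ d = cast (rename-id M) (rename-⊢ˢ id Γ⊆Δ d)

∩E-admissible : ∀ {Γ M A B} → Γ ⊢ˢ M ∶ (A ∩ B) → (Γ ⊢ˢ M ∶ A) × (Γ ⊢ˢ M ∶ B)
∩E-admissible (Ax m) =
  L∩-∈ {Ns = []} m (Ax (here refl)) , L∩-∈ {Ns = []} m (Ax (there (here refl)))
∩E-admissible (Beta {M = M} {Ns = Ns} d₁ d₂) =
  let d₁ᴬ , d₁ᴮ = ∩E-admissible d₁ in
  Beta {M = M} {Ns = Ns} d₁ᴬ d₂ , Beta {M = M} {Ns = Ns} d₁ᴮ d₂
∩E-admissible (L→ {Ns = Ns} eq y∉Ns y∉Γ d₁ d₂) =
  let d₂ᴬ , d₂ᴮ = ∩E-admissible d₂ in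
  L→ {Ns = Ns} eq y∉Ns y∉Γ d₁ d₂ᴬ , L→ {Ns = Ns} eq y∉Ns y∉Γ d₁ d₂ᴮ
∩E-admissible (L∩ {Ns = Ns} eq d) =
  let dᴬ , dᴮ = ∩E-admissible d in L∩ {Ns = Ns} eq dᴬ , L∩ {Ns = Ns} eq dᴮ
∩E-admissible (R∩ dᴬ dᴮ) = dᴬ , dᴮ

-- Cut elimination

size : Type → ℕ
size (atom _) = 1
size (A ⇒ B)  = suc (size A + size B)
size (A ∩ B)  = suc (size A + size B)

size-⇒ˡ : ∀ A B → size A < size (A ⇒ B)
size-⇒ˡ A B = s≤s (m≤m+n (size A) (size B))

size-⇒ʳ : ∀ A B → size B < size (A ⇒ B)
size-⇒ʳ A B = s≤s (m≤n+m (size B) (size A))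

size-∩ˡ : ∀ A B → size A < size (A ∩ B)
size-∩ˡ A B = s≤s (m≤m+n (size A) (size B))

size-∩ʳ : ∀ A B → size B < size (A ∩ B)
size-∩ʳ A B = s≤s (m≤n+m (size B) (size A))

data Substituend (n : ℕ) (Δ : Ctx) (t : Term) (C : Type) : Set where
  var∈  : ∀ z → t ≡ var z → (z , C) ∈ Δ → Substituend n Δ t C
  typed : size C < n → Δ ⊢ˢ t ∶ C → Substituend n Δ t C

CutSubstitution : ℕ → (ℕ → Term) → Ctx → Ctx → Set
CutSubstitution n σ Γ Δ = ∀ {x C} → (x , C) ∈ Γ → Substituend n Δ (σ x) C

Substituend-weaken : ∀ {n Δ Δ′ t C} → (∀ {p} → p ∈ Δ → p ∈ Δ′) →
                     Substituend n Δ t C → Substituend n Δ′ t C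
Substituend-weaken Δ⊆Δ′ (var∈ z t≡z m) = var∈ z t≡z (Δ⊆Δ′ m)
Substituend-weaken Δ⊆Δ′ (typed lt d)   = typed lt (weaken-⊢ˢ Δ⊆Δ′ d)

Substituend-rename : ∀ {n Δ Δ′ t C ρ} → Renaming ρ Δ Δ′ →
                     Substituend n Δ t C → Substituend n Δ′ (rename ρ t) C
Substituend-rename {ρ = ρ} h (var∈ z t≡z m) = var∈ (ρ z) (cong (rename ρ) t≡z) (h m)
Substituend-rename {ρ = ρ} h (typed lt d)   = typed lt (rename-⊢ˢ ρ h d)

CutSubstitution-exts : ∀ {n σ Δ A} Γ → CutSubstitution n σ Γ Δ →
                       CutSubstitution n (exts σ) ((0 , A) ∷ shiftCtx Γ) ((0 , A) ∷ shiftCtx Δ)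
CutSubstitution-exts Γ g (here refl) = var∈ 0 refl (here refl)
CutSubstitution-exts Γ g (there m) with ∈-shiftCtx⁻ Γ m
... | v , refl , m′ = Substituend-rename Renaming-suc (g m′)

CutSubstitution-update : ∀ {n σ Γ Δ y t A} → y ∉dom Γ → CutSubstitution n σ Γ Δ →
                         Substituend n Δ t A → CutSubstitution n (update σ y t) ((y , A) ∷ Γ) Δ
CutSubstitution-update {σ = σ} {y = y} {t} y∉Γ g s (here refl) =
  subst (λ u → Substituend _ _ u _) (sym (update-≡ σ y t)) s
CutSubstitution-update {σ = σ} {y = y} {t} y∉Γ g s {x} (there m) =
  subst (λ u → Substituend _ _ u _) (sym (update-≢ σ y t x (∉dom⇒≢ y∉Γ m))) (g m)

-- app-⊢ˢ carries a renaming because in the L→ case the fresh variable of the premise has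
-- to be renamed away from the new argument N, and a renamed premise would not be a
-- structurally smaller derivation.
mutual
  app-⊢ˢ : ∀ n {Γ Δ M N A B} ρ → Renaming ρ Γ Δ → size (A ⇒ B) ≤ n →
           Γ ⊢ˢ M ∶ (A ⇒ B) → Δ ⊢ˢ N ∶ A → Δ ⊢ˢ app (rename ρ M) N ∶ B
  app-⊢ˢ n ρ h sz (Ax m) dN = L→-∈ {Ns = []} (h m) dN (λ _ → Ax (here refl))
  app-⊢ˢ n {N = N} ρ h sz (Beta {M = M} {N′} {Ns} d₁ d₂) dN =
    cast (sym (rename-·⃗-snoc ρ (app (lam M) N′) Ns N))
      (Beta {M = rename (ext ρ) M} {Ns = map (rename ρ) Ns ++ N ∷ []}
        (cast (trans (rename-·⃗-snoc ρ _ Ns N) (cong (_·⃗ (map (rename ρ) Ns ++ N ∷ [])) (rename-[0:=] ρ N′ M)))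
              (app-⊢ˢ n ρ h sz d₁ dN))
        (rename-⊢ˢ ρ h d₂))
  app-⊢ˢ n {Δ = Δ} {N = N} ρ h sz (L→ {Γ₀} {x = x} {y = y} {N₁} {Ns} eq y∉Ns y∉Γ d₁ d₂) dN =
    cast (sym (rename-·⃗-snoc ρ (app (var x) N₁) Ns N))
      (L→-∈ {Ns = map (rename ρ) Ns ++ N ∷ []} (h (≋-here eq)) (rename-⊢ˢ ρ h₀ d₁) λ y′ →
        cast (trans (cong (λ X → app X N) (rename-update-head ρ y′ y∉Ns))
                    (·⃗-snoc (var y′) (map (rename ρ) Ns) N))
             (app-⊢ˢ n (update ρ y y′) (Renaming-update y∉Γ h₀) sz d₂ (weaken-⊢ˢ there dN)))
    where
    h₀ : Renaming ρ Γ₀ Δ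
    h₀ m = h (≋-there eq m)
  app-⊢ˢ n {N = N} ρ h sz (L∩ {x = x} {Ns} eq d) dN =
    cast (sym (rename-·⃗-snoc ρ (var x) Ns N))
      (L∩-∈ {Ns = map (rename ρ) Ns ++ N ∷ []} (h (≋-here eq))
        (cast (rename-·⃗-snoc ρ (var x) Ns N)
              (app-⊢ˢ n ρ (Renaming-∷ (Renaming-∷ λ m → h (≋-there eq m))) sz d
                      (weaken-⊢ˢ (there ∘ there) dN))))
  app-⊢ˢ n {Δ = Δ} {N = N} {A} {B} ρ h sz (R→ {Γ} {M} d) dN =
    Beta {Ns = []} (cast (•-rename-[0:=] N ρ M) (substitute-⊢ˢ n (N • (var ∘ ρ)) g d)) dN
    where
    g : CutSubstitution n (N • (var ∘ ρ)) ((0 , A) ∷ shiftCtx Γ) Δ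
    g (here refl) = typed (<-≤-trans (size-⇒ˡ A B) sz) dN
    g (there m) with ∈-shiftCtx⁻ Γ m
    ... | v , refl , m′ = var∈ (ρ v) refl (h m′)

  app-⊢ˢ-< : ∀ n {Δ M N A B} → size (A ⇒ B) < n →
             Δ ⊢ˢ M ∶ (A ⇒ B) → Δ ⊢ˢ N ∶ A → Δ ⊢ˢ app M N ∶ B
  app-⊢ˢ-< (suc n) {M = M} (s≤s sz) dM dN =
    cast (cong (λ X → app X _) (rename-id M)) (app-⊢ˢ n id id sz dM dN)

  substitute-⊢ˢ : ∀ n {Γ Δ M C} σ → CutSubstitution n σ Γ Δ →
                  Γ ⊢ˢ M ∶ C → Δ ⊢ˢ substitute σ M ∶ C
  substitute-⊢ˢ n σ g (Ax m) with g m
  ... | var∈ z σx≡z m′ = cast (sym σx≡z) (Ax m′)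
  ... | typed _ d      = d
  substitute-⊢ˢ n σ g (Beta {M = M} {N} {Ns} d₁ d₂) =
    cast (sym (substitute-·⃗ σ (app (lam M) N) Ns))
      (Beta {M = substitute (exts σ) M} {Ns = map (substitute σ) Ns}
        (cast (trans (substitute-·⃗ σ _ Ns) (cong (_·⃗ map (substitute σ) Ns) (substitute-[0:=] σ N M)))
              (substitute-⊢ˢ n σ g d₁))
        (substitute-⊢ˢ n σ g d₂))
  substitute-⊢ˢ n {Δ = Δ} σ g (L→ {Γ₀} {x = x} {y = y} {N} {Ns} {A₁} {A₂} eq y∉Ns y∉Γ d₁ d₂)
    with g (≋-here eq)
  ... | var∈ z σx≡z m =
    cast (sym (trans (substitute-·⃗ σ (app (var x) N) Ns)
                     (cong (λ X → app X (substitute σ N) ·⃗ map (substitute σ) Ns) σx≡z)))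
      (L→-∈ {Ns = map (substitute σ) Ns} m (substitute-⊢ˢ n σ g₀ d₁) λ y′ →
        cast (substitute-update-head σ (var y′) y∉Ns)
          (substitute-⊢ˢ n (update σ y (var y′))
            (CutSubstitution-update y∉Γ (λ m → Substituend-weaken there (g₀ m)) (var∈ y′ refl (here refl)))
            d₂))
    where
    g₀ : CutSubstitution n σ Γ₀ Δ
    g₀ m = g (≋-there eq m)
  ... | typed lt dx =
    cast (trans (substitute-update-head σ t y∉Ns) (sym (substitute-·⃗ σ (app (var x) N) Ns)))
      (substitute-⊢ˢ n (update σ y t)
        (CutSubstitution-update y∉Γ g₀ (typed (<-trans (size-⇒ʳ A₁ A₂) lt) dt)) d₂)
    where
    g₀ : CutSubstitution n σ Γ₀ Δ
    g₀ m = g (≋-there eq m)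
    t  = app (σ x) (substitute σ N)
    dt = app-⊢ˢ-< n lt dx (substitute-⊢ˢ n σ g₀ d₁)
  substitute-⊢ˢ n σ g (R→ {Γ} d) = R→ (substitute-⊢ˢ n (exts σ) (CutSubstitution-exts Γ g) d)
  substitute-⊢ˢ n σ g (L∩ {x = x} {Ns} {A₁} {A₂} eq d) with g (≋-here eq)
  ... | var∈ z σx≡z m =
    cast (sym e) (L∩-∈ {Ns = map (substitute σ) Ns} m (cast e (substitute-⊢ˢ n σ g′ d)))
    where
    e = trans (substitute-·⃗ σ (var x) Ns) (cong (_·⃗ map (substitute σ) Ns) σx≡z)
    g′ : CutSubstitution n σ ((x , A₁) ∷ (x , A₂) ∷ _) ((z , A₁) ∷ (z , A₂) ∷ _)
    g′ (here refl)         = var∈ z σx≡z (here refl)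
    g′ (there (here refl)) = var∈ z σx≡z (there (here refl))
    g′ (there (there m′))  = Substituend-weaken (there ∘ there) (g (≋-there eq m′))
  ... | typed lt dx = substitute-⊢ˢ n σ g′ d
    where
    g′ : CutSubstitution n σ ((x , A₁) ∷ (x , A₂) ∷ _) _
    g′ (here refl)         = typed (<-trans (size-∩ˡ A₁ A₂) lt) (proj₁ (∩E-admissible dx))
    g′ (there (here refl)) = typed (<-trans (size-∩ʳ A₁ A₂) lt) (proj₂ (∩E-admissible dx))
    g′ (there (there m′))  = g (≋-there eq m′)
  substitute-⊢ˢ n σ g (R∩ d₁ d₂) = R∩ (substitute-⊢ˢ n σ g d₁) (substitute-⊢ˢ n σ g d₂)

→E-admissible : ∀ {Γ M N A B} → Γ ⊢ˢ M ∶ (A ⇒ B) → Γ ⊢ˢ N ∶ A → Γ ⊢ˢ app M N ∶ B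
→E-admissible {A = A} {B} = app-⊢ˢ-< (suc (size (A ⇒ B))) ≤-refl

theorem2 : ∀ {Γ M A} → Γ ⊢ M ∶ A → Γ ⊢ˢ M ∶ A
theorem2 (Ax _ m)   = Ax m
theorem2 (→I d)     = R→ (theorem2 d)
theorem2 (→E d₁ d₂) = →E-admissible (theorem2 d₁) (theorem2 d₂)
theorem2 (∩I d₁ d₂) = R∩ (theorem2 d₁) (theorem2 d₂)
theorem2 (∩E₁ d)    = proj₁ (∩E-admissible (theorem2 d))
theorem2 (∩E₂ d)    = proj₂ (∩E-admissible (theorem2 d))
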